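{- For every nonnegative integer $n$, the number of self-conjugate odd Ferrers graphs of weight $2n+1$ equals the number of self-conjugate partitions of $4n+1$ all of whose parts are odd. That is, $|\mathcal{O}_{2n+1}| = |\mathcal{S}_{4n+1}|$.
   Context: An odd Ferrers graph is the Ferrers diagram (rows of left-justified boxes, row lengths weakly decreasing from top to bottom) of a partition in which every box of the first row and every box of the first column contains the number 1, and every other box contains the number 2. The weight of an odd Ferrers graph is the sum of all the numbers in its boxes; equivalently, reading the row sums from top to bottom gives the partition it represents (e.g. the diagram with row lengths $7,4,2,1$ represents $7+7+3+1$, of weight $18$). An odd Ferrers graph is self-conjugate if its underlying Ferrers diagram (shape) is self-conjugate, i.e. equal to its transpose. $\mathcal{O}_{2n+1}$ denotes the set of self-conjugate odd Ferrers graphs of weight $2n+1$. $\mathcal{S}_{4n+1}$ denotes the set of self-conjugate partitions of $4n+1$ (partitions equal to their conjugate) in which every part is odd. -}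

module Defs where

open import Data.Nat using (ℕ; zero; suc; _+_; _*_; _∸_; _≤ᵇ_; _≡ᵇ_)
open import Data.Bool using (Bool; true; false; _∧_; not)
open import Data.List using (List; []; _∷_; length; filter; applyUpTo)
open import Data.Nat.ListAction using (sum)
open import Data.List.Properties using (≡-dec)
open import Data.Nat.Properties using (_≤?_; _≟_)
open import Data.Nat.Base using (_≤_)
open import Relation.Nullary.Decidable using (isYes)
open import Data.Nat.Base using (_%_)

-- A partition is represented as the list of its parts (row lengths),
-- from top to bottom: all parts positive and weakly decreasing.
isPartition : List ℕ → Bool
isPartition [] = true
isPartition (a ∷ []) = not (a ≡ᵇ 0)
isPartition (a ∷ b ∷ l) = (b ≤ᵇ a) ∧ isPartition (b ∷ l)

countGE : ℕ → List ℕ → ℕ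
countGE j l = length (filter (λ x → j ≤? x) l)

conj : List ℕ → List ℕ
conj [] = []
conj (a ∷ l) = applyUpTo (λ i → countGE (suc i) (a ∷ l)) a

selfConjugate : List ℕ → Bool
selfConjugate l = isYes (≡-dec _≟_ (conj l) l)

-- Weight of the odd Ferrers graph with shape l: first row has all boxes 1
-- (row sum = first part); every later row of length r has a leading 1
-- (first column) and r-1 boxes containing 2, so row sum 2r-1.
ofgRowSums : List ℕ → List ℕ
ofgRowSums [] = []
ofgRowSums (a ∷ l) = a ∷ go l
  where
  go : List ℕ → List ℕ
  go [] = []
  go (r ∷ rs) = (1 + 2 * (r ∸ 1)) ∷ go rs

ofgWeight : List ℕ → ℕ
ofgWeight l = sum (ofgRowSums l)

-- membership in 𝒪_{2n+1}: self-conjugate odd Ferrers graphs of weight 2n+1,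
-- an odd Ferrers graph being determined by its shape.
inO : ℕ → List ℕ → Bool
inO n l = isPartition l ∧ selfConjugate l ∧ (ofgWeight l ≡ᵇ (2 * n + 1))

allOdd : List ℕ → Bool
allOdd [] = true
allOdd (x ∷ l) = ((x % 2) ≡ᵇ 1) ∧ allOdd l

inS : ℕ → List ℕ → Bool
inS n l = isPartition l ∧ selfConjugate l ∧ allOdd l
          ∧ (sum l ≡ᵇ (4 * n + 1))

module Submission where

-- The map  oddify  sends
-- a shape (a, r₁, r₂, …) to (2a−1, 2r₁−1, 2r₁−1, 2r₂−1, 2r₂−1, …): the first
-- row becomes one odd part, every later row two equal odd parts; its left
-- inverse  halve  takes ⌈x/2⌉ of the first part and of every second later part.
--   * Counting: parts of a conjugate count parts above a threshold, and
--     thresholds on odd lengths match thresholds on the original lengths,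
--     so  conj (oddify l) ≡ oddify (conj l).
--   * Shape and weight: oddify preserves being a partition, and for positive
--     parts  sum (oddify l) = 2·(odd Ferrers graph weight of l) − 1;
--     hence  inS n (oddify l) ≡ inO n l  as Boolean tests.
--   * Image: an odd-part partition has as many parts ≥ 2j+2 as ≥ 2j+3, so a
--     self-conjugate one has its later parts in equal pairs: it is oddify ν.

open import Defs
open import Data.Nat using (ℕ)
open import Data.List using (List)
open import Data.Product using (Σ)
open import Data.Bool using (T)
open import Function.Bundles using (_↔_)

open import Data.Nat using (zero; suc; _+_; _*_; _∸_; _≤_; _<_; _≡ᵇ_; _%_; _/_; ⌊_/2⌋; ⌈_/2⌉; z≤n; s≤s)
open import Data.Nat.Properties using (_≤?_; ≤-refl; ≤-trans; n≤1+n; m≤n⇒m≤1+n; <⇒≤; ≤ᵇ⇒≤; ≤⇒≤ᵇ; ≡ᵇ⇒≡; ≡⇒≡ᵇ; ≤ᵇ-reflects-≤; *-cancelˡ-≡; 0≢1+n; +-comm)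
open import Data.Nat.DivMod using (m≡m%n+[m/n]*n; [m+kn]%n≡m%n)
open import Data.Nat.ListAction using (sum)
open import Data.Nat.Tactic.RingSolver using (solve-∀)
open import Data.List using ([]; _∷_; length; applyUpTo)
open import Data.List.Properties using (filter-accept; filter-reject; ∷-injectiveʳ)
open import Data.List.Relation.Unary.All using (All; []; _∷_)
open import Data.List.Relation.Unary.All.Properties using (applyUpTo⁻)
open import Data.Product using (_,_; ∃-syntax; proj₁; proj₂)
open import Data.Product.Properties using (Σ-≡,≡→≡)
open import Data.Bool using (Bool; true; false; _∧_)
open import Data.Bool.Properties using (T-∧; T-irrelevant)
open import Data.Unit using (tt)
open import Data.Empty using (⊥-elim)
open import Function using (_∘_)
open import Function.Bundles using (_⇔_; mk⇔; mk↔ₛ′; Equivalence)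
open import Relation.Nullary using (¬_; yes; no)
open import Relation.Nullary.Reflects using (ofʸ; fromEquivalence; T-reflects-elim; det)
open import Relation.Nullary.Decidable using (toWitness; fromWitness)
open import Relation.Binary.PropositionalEquality using (_≡_; refl; sym; trans; cong; cong₂; subst; module ≡-Reasoning)

open Equivalence using (to; from)

T-ext : ∀ {b c} → (T b → T c) → (T c → T b) → b ≡ c
T-ext f g = T-reflects-elim (fromEquivalence f g)

∧-congˡ-guarded : ∀ {b c d} → (T b → c ≡ d) → (b ∧ c) ≡ (b ∧ d)
∧-congˡ-guarded {true} e = e tt
∧-congˡ-guarded {false} _ = refl

-- double k = 2k and oddNum k = 2k − 1 (with oddNum 0 = 0), defined by
-- recursion so that comparisons between them reduce by pattern matching.
double : ℕ → ℕ
double zero = zero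
double (suc k) = suc (suc (double k))

oddNum : ℕ → ℕ
oddNum zero = zero
oddNum (suc k) = suc (double k)

double≡ : ∀ k → double k ≡ k * 2
double≡ zero = refl
double≡ (suc k) = cong (suc ∘ suc) (double≡ k)

double-mono : ∀ {k m} → k ≤ m → double k ≤ double m
double-mono z≤n = z≤n
double-mono (s≤s p) = s≤s (s≤s (double-mono p))

double-cancel-odd : ∀ {k m} → double k ≤ suc (double m) → k ≤ m
double-cancel-odd {zero} _ = z≤n
double-cancel-odd {suc k} {zero} (s≤s ())
double-cancel-odd {suc k} {suc m} (s≤s (s≤s p)) = s≤s (double-cancel-odd p)

double-cancel-strict : ∀ {k m} → suc (double k) ≤ double m → suc k ≤ m
double-cancel-strict {m = suc m} (s≤s p) = s≤s (double-cancel-odd p)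

double-strict : ∀ {k m} → suc k ≤ m → suc (double k) ≤ double m
double-strict p = <⇒≤ (double-mono p)

⌊double/2⌋ : ∀ k → ⌊ double k /2⌋ ≡ k
⌊double/2⌋ zero = refl
⌊double/2⌋ (suc k) = cong suc (⌊double/2⌋ k)

⌈oddNum/2⌉ : ∀ k → ⌈ oddNum k /2⌉ ≡ k
⌈oddNum/2⌉ zero = refl
⌈oddNum/2⌉ (suc k) = cong suc (⌊double/2⌋ k)

IsOdd : ℕ → Set
IsOdd x = ∃[ m ] x ≡ oddNum (suc m)

oddNum-⌈/2⌉ : ∀ {x} → IsOdd x → oddNum ⌈ x /2⌉ ≡ x
oddNum-⌈/2⌉ (m , refl) = cong oddNum (⌈oddNum/2⌉ (suc m))

odd⇒%2 : ∀ {x} → IsOdd x → T (x % 2 ≡ᵇ 1)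
odd⇒%2 (m , refl) = ≡⇒≡ᵇ _ 1 (trans (cong (λ z → suc z % 2) (double≡ m)) ([m+kn]%n≡m%n 1 m 2))

%2⇒odd : ∀ x → T (x % 2 ≡ᵇ 1) → IsOdd x
%2⇒odd x t = x / 2 , (begin
  x                     ≡⟨ m≡m%n+[m/n]*n x 2 ⟩
  x % 2 + (x / 2) * 2   ≡⟨ cong (_+ (x / 2) * 2) (≡ᵇ⇒≡ _ 1 t) ⟩
  suc ((x / 2) * 2)     ≡⟨ cong suc (double≡ (x / 2)) ⟨
  oddNum (suc (x / 2))  ∎)
  where open ≡-Reasoning

allOdd⇒ : ∀ l → T (allOdd l) → All IsOdd l
allOdd⇒ [] _ = []
allOdd⇒ (x ∷ l) t = %2⇒odd x (proj₁ (to T-∧ t)) ∷ allOdd⇒ l (proj₂ (to T-∧ t))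

allOdd⇐ : ∀ {l} → All IsOdd l → T (allOdd l)
allOdd⇐ [] = tt
allOdd⇐ (ox ∷ ol) = from T-∧ (odd⇒%2 ox , allOdd⇐ ol)

ThresholdsMatch : ℕ → ℕ → Set
ThresholdsMatch t t' = ∀ x → (t ≤ oddNum x) ⇔ (t' ≤ x)

oddThreshold : ∀ k → ThresholdsMatch (oddNum (suc k)) (suc k)
oddThreshold k zero = mk⇔ (λ ()) (λ ())
oddThreshold k (suc x) =
  mk⇔ (λ { (s≤s p) → s≤s (double-cancel-odd (m≤n⇒m≤1+n p)) })
      (λ { (s≤s p) → s≤s (double-mono p) })

evenThreshold : ∀ k → ThresholdsMatch (double (suc k)) (suc (suc k))
evenThreshold k zero = mk⇔ (λ ()) (λ ())
evenThreshold k (suc x) =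
  mk⇔ (λ { (s≤s p) → s≤s (double-cancel-strict p) })
      (λ { (s≤s p) → s≤s (<⇒≤ (double-mono p)) })

oddLength-threshold : ∀ j x → IsOdd x → (double (suc j) ≤ x) ⇔ (suc (double (suc j)) ≤ x)
oddLength-threshold j x (m , refl) =
  mk⇔ (λ { (s≤s p) → s≤s (double-mono (double-cancel-strict p)) })
      (≤-trans (n≤1+n _))

oddNum-≤ : ∀ b a → (oddNum b ≤ oddNum a) ⇔ (b ≤ a)
oddNum-≤ zero a = mk⇔ (λ _ → z≤n) (λ _ → z≤n)
oddNum-≤ (suc b) a = oddThreshold b a

countGE-accept : ∀ {t x} l → t ≤ x → countGE t (x ∷ l) ≡ suc (countGE t l)
countGE-accept {t} l p = cong length (filter-accept (t ≤?_) p)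

countGE-reject : ∀ {t x} l → ¬ t ≤ x → countGE t (x ∷ l) ≡ countGE t l
countGE-reject {t} l p = cong length (filter-reject (t ≤?_) p)

countGE-resp : ∀ {P : ℕ → Set} {t t'} → (∀ x → P x → (t ≤ x) ⇔ (t' ≤ x))
             → ∀ {l} → All P l → countGE t l ≡ countGE t' l
countGE-resp eq [] = refl
countGE-resp {t = t} eq {x ∷ l} (px ∷ pl) with t ≤? x
... | yes p = trans (countGE-accept l p)
               (trans (cong suc (countGE-resp eq pl)) (sym (countGE-accept l (to (eq x px) p))))
... | no ¬p = trans (countGE-reject l ¬p)
               (trans (countGE-resp eq pl) (sym (countGE-reject l (¬p ∘ from (eq x px)))))

pairRows : List ℕ → List ℕ
pairRows [] = []
pairRows (r ∷ rs) = oddNum r ∷ oddNum r ∷ pairRows rs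

oddify : List ℕ → List ℕ
oddify [] = []
oddify (a ∷ l) = oddNum a ∷ pairRows l

unpairRows : List ℕ → List ℕ
unpairRows (x ∷ _ ∷ rs) = ⌈ x /2⌉ ∷ unpairRows rs
unpairRows _ = []

halve : List ℕ → List ℕ
halve [] = []
halve (a ∷ l) = ⌈ a /2⌉ ∷ unpairRows l

halve-oddify : ∀ l → halve (oddify l) ≡ l
halve-oddify [] = refl
halve-oddify (a ∷ l) = cong₂ _∷_ (⌈oddNum/2⌉ a) (unpair-pair l)
  where
  unpair-pair : ∀ l → unpairRows (pairRows l) ≡ l
  unpair-pair [] = refl
  unpair-pair (r ∷ rs) = cong₂ _∷_ (⌈oddNum/2⌉ r) (unpair-pair rs)

oddify-injective : ∀ {x y} → oddify x ≡ oddify y → x ≡ y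
oddify-injective {x} {y} e = trans (sym (halve-oddify x)) (trans (cong halve e) (halve-oddify y))

countGE-pairRows : ∀ {t t'} → ThresholdsMatch t t' → ∀ l → countGE t (pairRows l) ≡ double (countGE t' l)
countGE-pairRows match [] = refl
countGE-pairRows {t} {t'} match (r ∷ rs) with t' ≤? r
... | yes p = trans (countGE-accept (oddNum r ∷ pairRows rs) p')
                (trans (cong suc (countGE-accept (pairRows rs) p'))
                (trans (cong (suc ∘ suc) (countGE-pairRows match rs)) (cong double (sym (countGE-accept rs p)))))
  where
  p' : t ≤ oddNum r
  p' = from (match r) p
... | no ¬p = trans (countGE-reject (oddNum r ∷ pairRows rs) ¬p')
                (trans (countGE-reject (pairRows rs) ¬p')
                (trans (countGE-pairRows match rs) (cong double (sym (countGE-reject rs ¬p)))))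
  where
  ¬p' : ¬ t ≤ oddNum r
  ¬p' = ¬p ∘ to (match r)

countGE-oddify : ∀ {t t'} → ThresholdsMatch t t' → ∀ a l → t' ≤ a
               → countGE t (oddify (a ∷ l)) ≡ oddNum (countGE t' (a ∷ l))
countGE-oddify match a l p =
  trans (countGE-accept (pairRows l) (from (match a) p))
        (trans (cong suc (countGE-pairRows match l)) (cong oddNum (sym (countGE-accept l p))))

applyUpTo-paired : ∀ (G H : ℕ → ℕ) m
                 → (∀ k → k < m → G (double k) ≡ oddNum (H k))
                 → (∀ k → k < m → G (suc (double k)) ≡ oddNum (H k))
                 → applyUpTo G (double m) ≡ pairRows (applyUpTo H m)
applyUpTo-paired G H zero _ _ = refl
applyUpTo-paired G H (suc m) even odd =
  cong₂ _∷_ (even 0 (s≤s z≤n)) (cong₂ _∷_ (odd 0 (s≤s z≤n))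
    (applyUpTo-paired (G ∘ suc ∘ suc) (H ∘ suc) m (λ k → even (suc k) ∘ s≤s) (λ k → odd (suc k) ∘ s≤s)))

conj-oddify : ∀ l → conj (oddify l) ≡ oddify (conj l)
conj-oddify [] = refl
conj-oddify (zero ∷ l) = refl
conj-oddify (suc m ∷ l) =
  cong₂ _∷_ (countGE-oddify (oddThreshold 0) (suc m) l (s≤s z≤n))
    (applyUpTo-paired _ _ m (λ k p → countGE-oddify (evenThreshold k) (suc m) l (s≤s p))
                            (λ k p → countGE-oddify (oddThreshold (suc k)) (suc m) l (s≤s p)))

isPartition-oddify : ∀ l → isPartition (oddify l) ≡ isPartition l
isPartition-oddify [] = refl
isPartition-oddify (zero ∷ []) = refl
isPartition-oddify (suc a ∷ []) = refl
isPartition-oddify (a ∷ b ∷ l) =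
  cong₂ _∧_ (T-ext (≤⇒≤ᵇ ∘ to (oddNum-≤ b a) ∘ ≤ᵇ⇒≤ _ _) (≤⇒≤ᵇ ∘ from (oddNum-≤ b a) ∘ ≤ᵇ⇒≤ _ _))
    (trans (cong (_∧ isPartition (oddify (b ∷ l))) (det (≤ᵇ-reflects-≤ _ _) (ofʸ (≤-refl {oddNum b})))) (isPartition-oddify (b ∷ l)))

selfConjugate-oddify : ∀ l → selfConjugate (oddify l) ≡ selfConjugate l
selfConjugate-oddify l =
  T-ext (λ t → fromWitness (oddify-injective (trans (sym (conj-oddify l)) (toWitness t))))
        (λ t → fromWitness (trans (conj-oddify l) (cong oddify (toWitness t))))

Positive : List ℕ → Set
Positive = All (1 ≤_)

partition⇒positive : ∀ l → T (isPartition l) → Positive l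
partition⇒positive [] _ = []
partition⇒positive (suc a ∷ []) _ = s≤s z≤n ∷ []
partition⇒positive (a ∷ b ∷ l) t with partition⇒positive (b ∷ l) (proj₂ (to T-∧ t))
... | pb ∷ pl = ≤-trans pb (≤ᵇ⇒≤ b a (proj₁ (to T-∧ t))) ∷ pb ∷ pl

allOdd-oddify : ∀ {l} → Positive l → allOdd (oddify l) ≡ true
allOdd-oddify {l} pos = T-ext (λ _ → tt) (λ _ → allOdd⇐ (oddify-odd pos))
  where
  pairRows-odd : ∀ {l} → Positive l → All IsOdd (pairRows l)
  pairRows-odd [] = []
  pairRows-odd {suc r ∷ _} (_ ∷ pos) = (r , refl) ∷ (r , refl) ∷ pairRows-odd pos
  oddify-odd : ∀ {l} → Positive l → All IsOdd (oddify l)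
  oddify-odd [] = []
  oddify-odd {suc a ∷ _} (_ ∷ pos) = (a , refl) ∷ pairRows-odd pos

laterRowsWeight : List ℕ → ℕ
laterRowsWeight l = ofgWeight (0 ∷ l)

sum-pairRows : ∀ {l} → Positive l → sum (pairRows l) ≡ 2 * laterRowsWeight l
sum-pairRows [] = refl
sum-pairRows {suc r ∷ rs} (_ ∷ pos) = begin
  suc (double r) + (suc (double r) + sum (pairRows rs))
    ≡⟨ cong₂ (λ u v → suc u + (suc u + v)) (double≡ r) (sum-pairRows pos) ⟩
  suc (r * 2) + (suc (r * 2) + 2 * laterRowsWeight rs)
    ≡⟨ arith r (laterRowsWeight rs) ⟩
  2 * ((1 + 2 * r) + laterRowsWeight rs) ∎
  where
  open ≡-Reasoning
  arith : ∀ r w → suc (r * 2) + (suc (r * 2) + 2 * w) ≡ 2 * ((1 + 2 * r) + w)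
  arith = solve-∀

sum-oddify : ∀ {l} → Positive l → sum (oddify l) ≡ 2 * ofgWeight l ∸ 1
sum-oddify [] = refl
sum-oddify {suc a ∷ l} (_ ∷ pos) = cong (_∸ 1) (begin
  suc (suc (double a) + sum (pairRows l))
    ≡⟨ cong₂ (λ u v → suc (suc u + v)) (double≡ a) (sum-pairRows pos) ⟩
  suc (suc (a * 2) + 2 * laterRowsWeight l)
    ≡⟨ arith a (laterRowsWeight l) ⟩
  2 * (suc a + laterRowsWeight l) ∎)
  where
  open ≡-Reasoning
  arith : ∀ a w → suc (suc (a * 2) + 2 * w) ≡ 2 * (suc a + w)
  arith = solve-∀

weight-equation : ∀ n w → (2 * w ∸ 1 ≡ 4 * n + 1) ⇔ (w ≡ 2 * n + 1)
weight-equation n w = mk⇔ (solve-for w) (λ { refl → cong (_∸ 1) (sym (arith n)) })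
  where
  arith : ∀ n → suc (4 * n + 1) ≡ 2 * (2 * n + 1)
  arith = solve-∀
  solve-for : ∀ w → 2 * w ∸ 1 ≡ 4 * n + 1 → w ≡ 2 * n + 1
  solve-for zero e = ⊥-elim (0≢1+n (trans e (+-comm (4 * n) 1)))
  solve-for (suc w) e = *-cancelˡ-≡ (suc w) (2 * n + 1) 2 (trans (cong suc e) (arith n))

sumTest-oddify : ∀ n {l} → Positive l → (sum (oddify l) ≡ᵇ (4 * n + 1)) ≡ (ofgWeight l ≡ᵇ (2 * n + 1))
sumTest-oddify n {l} pos =
  T-ext (λ t → ≡⇒≡ᵇ w (2 * n + 1) (to (weight-equation n w) (trans (sym (sum-oddify pos)) (≡ᵇ⇒≡ s (4 * n + 1) t))))
        (λ t → ≡⇒≡ᵇ s (4 * n + 1) (trans (sum-oddify pos) (from (weight-equation n w) (≡ᵇ⇒≡ w (2 * n + 1) t))))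
  where
  s w : ℕ
  s = sum (oddify l)
  w = ofgWeight l

inS-oddify : ∀ n l → inS n (oddify l) ≡ inO n l
inS-oddify n l =
  trans (cong (_∧ selfConjugate (oddify l) ∧ oddAndSum) (isPartition-oddify l))
        (∧-congˡ-guarded (λ isPart →
          let pos = partition⇒positive l isPart in
          cong₂ _∧_ (selfConjugate-oddify l)
                    (trans (cong (_∧ sumTest) (allOdd-oddify pos)) (sumTest-oddify n pos))))
  where
  sumTest : Bool
  sumTest = sum (oddify l) ≡ᵇ (4 * n + 1)
  oddAndSum : Bool
  oddAndSum = allOdd (oddify l) ∧ sumTest

oddSelfConjugate⇒image : ∀ μ → All IsOdd μ → conj μ ≡ μ → ∃[ ν ] μ ≡ oddify ν
oddSelfConjugate⇒image [] _ _ = [] , refl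
oddSelfConjugate⇒image (a ∷ l) oddParts@((m , refl) ∷ oddl) selfConj =
  suc m ∷ applyUpTo H m , cong (oddNum (suc m) ∷_) laterRows
  where
  -- the later parts of μ are the later parts of its conjugate
  G : ℕ → ℕ
  G i = countGE (suc (suc i)) (a ∷ l)
  H : ℕ → ℕ
  H k = ⌈ G (double k) /2⌉
  l≡ : l ≡ applyUpTo G (double m)
  l≡ = sym (∷-injectiveʳ selfConj)
  oddEntry : ∀ k → k < m → oddNum (H k) ≡ G (double k)
  oddEntry k p = oddNum-⌈/2⌉ (applyUpTo⁻ G (double m) (subst (All IsOdd) l≡ oddl) (double-strict p))
  pairedEntry : ∀ k → G (suc (double k)) ≡ G (double k)
  pairedEntry k = sym (countGE-resp (oddLength-threshold k) oddParts)
  laterRows : l ≡ pairRows (applyUpTo H m)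
  laterRows = trans l≡ (applyUpTo-paired G H m (λ k p → sym (oddEntry k p))
                                              (λ k p → trans (pairedEntry k) (sym (oddEntry k p))))

oddify-halve : ∀ n μ → T (inS n μ) → oddify (halve μ) ≡ μ
oddify-halve n μ t with oddSelfConjugate⇒image μ (allOdd⇒ μ oddTest) (toWitness scTest)
  where
  afterPartition : T (selfConjugate μ ∧ allOdd μ ∧ (sum μ ≡ᵇ (4 * n + 1)))
  afterPartition = proj₂ (to (T-∧ {isPartition μ}) t)
  scTest : T (selfConjugate μ)
  scTest = proj₁ (to (T-∧ {selfConjugate μ}) afterPartition)
  oddTest : T (allOdd μ)
  oddTest = proj₁ (to (T-∧ {allOdd μ}) (proj₂ (to (T-∧ {selfConjugate μ}) afterPartition)))
... | ν , refl = cong oddify (halve-oddify ν)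

Σ-restrict-↔ : ∀ {A B : Set} {P : A → Bool} {Q : B → Bool} (f : A → B) (g : B → A)
             → (∀ a → g (f a) ≡ a) → (∀ a → Q (f a) ≡ P a) → (∀ b → T (Q b) → f (g b) ≡ b)
             → Σ A (λ a → T (P a)) ↔ Σ B (λ b → T (Q b))
Σ-restrict-↔ {P = P} {Q} f g gf Qf fg = mk↔ₛ′ to′ from′ to∘from from∘to
  where
  to′ : Σ _ (λ a → T (P a)) → Σ _ (λ b → T (Q b))
  to′ (a , p) = f a , subst T (sym (Qf a)) p
  from′ : Σ _ (λ b → T (Q b)) → Σ _ (λ a → T (P a))
  from′ (b , q) = g b , subst T (Qf (g b)) (subst (T ∘ Q) (sym (fg b q)) q)
  to∘from : ∀ y → to′ (from′ y) ≡ y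
  to∘from (b , q) = Σ-≡,≡→≡ (fg b q , T-irrelevant _ _)
  from∘to : ∀ x → from′ (to′ x) ≡ x
  from∘to (a , p) = Σ-≡,≡→≡ (gf a , T-irrelevant _ _)

theorem1 : (n : ℕ) → Σ (List ℕ) (λ l → T (inO n l)) ↔ Σ (List ℕ) (λ l → T (inS n l))
theorem1 n = Σ-restrict-↔ oddify halve halve-oddify (inS-oddify n) (oddify-halve n)
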